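{- For all positive integers $w_1$, there exists a $\overline{w}$-balanced $(6w_1+2,3)$-packing of size $6w_1^2+2w_1$, where $\overline{w}=(w_1, w_1,w_1)$.
   Context: For a composition $\overline{w}=(w_1,w_2,w_3)$ with total weight $w$ and $\lambda=\lceil w/w_1\rceil$ (here $\lambda=3$), a $\overline{w}$-balanced $(M,3)$-packing of size $n$ is a set $\mathcal{A}$ of $n$ triples in $(\mathbb{Z}_M\cup\{*\})^{3}$ (equivalently triples over any point set of size $M$) such that (T1) in each triple the non-$*$ entries are distinct and the sets of non-$*$ entries form an $(M,\{\lambda,\lambda-1\})$-packing (blocks of size $\lambda$ or $\lambda-1$, each pair of points in at most one block), and (T2) for each position $i\in[3]$, each point occurs in position $i$ exactly $w_i$ times in $\mathcal{A}$. -}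

module Defs where

open import Data.Nat using (ℕ; zero; suc; _+_; _*_; _∸_; NonZero)
open import Data.Nat.DivMod using (_/_)
open import Data.Fin using (Fin)
open import Data.Maybe using (Maybe; just; nothing; is-just)
open import Data.Maybe.Properties using (≡-dec)
open import Data.Fin.Properties using (_≟_)
open import Data.List using (List; length; filter; allFin)
open import Data.Bool using (T)
open import Data.Product using (_×_; ∃-syntax)
open import Data.Sum using (_⊎_)
open import Relation.Binary.PropositionalEquality using (_≡_; _≢_)
open import Relation.Nullary.Decidable using (T?)

-- A point of (ℤ_M ∪ {*}): `just x` is the point x ∈ Fin M, `nothing` is *.
Entry : ℕ → Set
Entry M = Maybe (Fin M)

Triples : ℕ → ℕ → Set
Triples M n = Fin n → Fin 3 → Entry M

_∈ₜ_ : ∀ {M} → Fin M → (Fin 3 → Entry M) → Set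
x ∈ₜ T = ∃[ i ] T i ≡ just x

blockSize : ∀ {M} → (Fin 3 → Entry M) → ℕ
blockSize {M} T = length (filter (λ i → T? (is-just (T i))) (allFin 3))

occ : ∀ {M n} → Triples M n → Fin 3 → Fin M → ℕ
occ {M} {n} A i x = length (filter (λ t → ≡-dec _≟_ (A t i) (just x)) (allFin n))

-- λ = ⌈ w / w₁ ⌉ with w = w₁ + w₂ + w₃
lambda : (w₁ w₂ w₃ : ℕ) → .{{NonZero w₁}} → ℕ
lambda w₁ w₂ w₃ = ((w₁ + w₂ + w₃) + w₁ ∸ 1) / w₁

record IsBalancedPacking (M w₁ w₂ w₃ : ℕ) .{{_ : NonZero w₁}} {n : ℕ} (A : Triples M n) : Set where
  field
    distinct  : ∀ t (i j : Fin 3) (x : Fin M) → i ≢ j → A t i ≡ just x → A t j ≢ just x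
    blockSz   : ∀ t → blockSize (A t) ≡ lambda w₁ w₂ w₃ ⊎ blockSize (A t) ≡ lambda w₁ w₂ w₃ ∸ 1
    pairs     : ∀ (t u : Fin n) (x y : Fin M) → x ≢ y →
                x ∈ₜ A t → y ∈ₜ A t → x ∈ₜ A u → y ∈ₜ A u → t ≡ u
    balance₁  : ∀ x → occ A Fin.zero x ≡ w₁
    balance₂  : ∀ x → occ A (Fin.suc Fin.zero) x ≡ w₂
    balance₃  : ∀ x → occ A (Fin.suc (Fin.suc Fin.zero)) x ≡ w₃

module Submission where

-- Construction, with m = 2w + 1.  The points are the pairs (a , i) of a residue a ∈ ℤ_m and a
-- layer i ∈ {0,1,2}, except the origin (0 , 0): 3m - 1 = 6w + 2 points.  For each difference
-- d ∈ [1, w] and each point (a , i) there is one triple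
--     (a , i) , (a + 2e , i) , (a + e , i + 1),    e = d in layers 0, 1 and e = -2d in layer 2,
-- except that the two triples which would contain the origin, those of (-2d , 0) and (2d , 2),
-- become the vertical triples (a,0),(a,2),(a,1) and (a,2),(a,0),(a,1).  This gives w(6w + 2)
-- triples, all of size λ = ⌈3w / w⌉ = 3.
--
-- Packing: a key computed from a pair of points (midpoint and half-difference within a
-- layer, upper point and difference across layers, the residue for a vertical pair) sends any
-- two distinct points of a triple to the key of that triple, and a triple can be decoded from
-- its key.  Balance: position 0 of the triple of (a , i) is (a , i); for positions 1 and 2 the
-- triples are arranged in w columns in which every point occurs once in that position,
-- witnessed by explicit inverse maps.  Numbering points by Fin (6w+2) and triples by
-- Fin (6w²+2w), the occurrences of a point in a position become a residue class modulo 6w+2.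

open import Defs
open import Data.Nat using (ℕ; zero; suc; _+_; _*_; NonZero; ≢-nonZero⁻¹)
open import Data.Product using (∃-syntax; _,_)
open import Data.Empty using (⊥-elim)
open import Relation.Binary.PropositionalEquality using (refl)


module Counting where
  open import Data.Nat using (ℕ; zero; suc; _+_; _*_; _<_; z≤n; s≤s; NonZero; _%_; _≟_)
  open import Data.Nat.Properties using (+-0-commutativeMonoid; +-assoc; +-comm; suc-injective)
  open import Data.Nat.DivMod using (m<n⇒m%n≡m; [m+n]%n≡m%n)
  open import Data.Fin using (Fin; toℕ)
  import Data.Fin as F
  open import Data.List using (length; filter; allFin; tabulate)
  open import Data.Empty using (⊥-elim)
  open import Function using (_∘_)
  open import Relation.Nullary using (Dec; yes; no)
  open import Relation.Binary.PropositionalEquality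
  open import Algebra.Properties.CommutativeMonoid.Sum +-0-commutativeMonoid using (sum; sum-permute; sum-cong-≗)
  open import Data.Fin.Permutation using (Permutation; _⟨$⟩ʳ_)

  indicator : ∀ {p} {P : Set p} → Dec P → ℕ
  indicator (yes _) = 1
  indicator (no _) = 0

  indicator-⇔ : ∀ {p q} {P : Set p} {Q : Set q} (P? : Dec P) (Q? : Dec Q) →
                (P → Q) → (Q → P) → indicator P? ≡ indicator Q?
  indicator-⇔ (yes _) (yes _) _ _ = refl
  indicator-⇔ (yes p) (no ¬q) f _ = ⊥-elim (¬q (f p))
  indicator-⇔ (no ¬p) (yes q) _ g = ⊥-elim (¬p (g q))
  indicator-⇔ (no _)  (no _)  _ _ = refl

  length-filter-tabulate : ∀ {p} {A : Set} {P : A → Set p} (P? : ∀ x → Dec (P x)) {n} (f : Fin n → A) →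
                           length (filter P? (tabulate f)) ≡ sum (λ i → indicator (P? (f i)))
  length-filter-tabulate P? {zero}  f = refl
  length-filter-tabulate P? {suc n} f with P? (f F.zero)
  ... | yes _ = cong suc (length-filter-tabulate P? (f ∘ F.suc))
  ... | no _  = length-filter-tabulate P? (f ∘ F.suc)

  -- Sums over the range [0, N) of ℕ, which are easier to cut into blocks than sums over Fin N.
  rangeSum : (ℕ → ℕ) → ℕ → ℕ
  rangeSum f zero    = 0
  rangeSum f (suc N) = f 0 + rangeSum (f ∘ suc) N

  sum≡rangeSum : ∀ {N} (f : ℕ → ℕ) → sum {N} (f ∘ toℕ) ≡ rangeSum f N
  sum≡rangeSum {zero}  f = refl
  sum≡rangeSum {suc N} f = cong (f 0 +_) (sum≡rangeSum {N} (f ∘ suc))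

  rangeSum-cong : ∀ N {f g : ℕ → ℕ} → (∀ t → t < N → f t ≡ g t) → rangeSum f N ≡ rangeSum g N
  rangeSum-cong zero    _  = refl
  rangeSum-cong (suc N) eq = cong₂ _+_ (eq 0 (s≤s z≤n)) (rangeSum-cong N (λ t t<N → eq (suc t) (s≤s t<N)))

  rangeSum-+ : ∀ a b (f : ℕ → ℕ) → rangeSum f (a + b) ≡ rangeSum f a + rangeSum (λ t → f (a + t)) b
  rangeSum-+ zero    b f = refl
  rangeSum-+ (suc a) b f rewrite rangeSum-+ a b (f ∘ suc) = sym (+-assoc (f 0) _ _)

  rangeSum-delta : ∀ N x → x < N → rangeSum (λ t → indicator (t ≟ x)) N ≡ 1
  rangeSum-delta (suc N) zero    _         = cong suc (noneEqualZero N)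
    where
    noneEqualZero : ∀ N → rangeSum (λ t → indicator (suc t ≟ 0)) N ≡ 0
    noneEqualZero zero    = refl
    noneEqualZero (suc N) = noneEqualZero N
  rangeSum-delta (suc N) (suc x) (s≤s x<N) =
    trans (rangeSum-cong N (λ t _ → indicator-⇔ (suc t ≟ suc x) (t ≟ x) suc-injective (cong suc)))
          (rangeSum-delta N x x<N)

  residueCount : ∀ M .{{_ : NonZero M}} k x → x < M → rangeSum (λ t → indicator (t % M ≟ x)) (k * M) ≡ k
  residueCount M zero    x x<M = refl
  residueCount M (suc k) x x<M = begin
    rangeSum f (M + k * M)                           ≡⟨ rangeSum-+ M (k * M) f ⟩
    rangeSum f M + rangeSum (λ t → f (M + t)) (k * M) ≡⟨ cong₂ _+_ firstBlock laterBlocks ⟩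
    suc k                                             ∎
    where
    open ≡-Reasoning
    f : ℕ → ℕ
    f t = indicator (t % M ≟ x)
    firstBlock : rangeSum f M ≡ 1
    firstBlock = trans (rangeSum-cong M (λ t t<M → cong (λ r → indicator (r ≟ x)) (m<n⇒m%n≡m t<M)))
                       (rangeSum-delta M x x<M)
    laterBlocks : rangeSum (λ t → f (M + t)) (k * M) ≡ k
    laterBlocks = trans (rangeSum-cong (k * M) (λ t _ → cong (λ r → indicator (r ≟ x))
                          (trans (cong (_% M) (+-comm M t)) ([m+n]%n≡m%n t M))))
                        (residueCount M k x x<M)

  countViaResidues : ∀ {n} k M .{{_ : NonZero M}} → n ≡ k * M → (π : Permutation n n) (x : ℕ) → x < M →
                     ∀ {p} {P : Fin n → Set p} (P? : ∀ t → Dec (P t)) →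
                     (∀ t → P (π ⟨$⟩ʳ t) → toℕ t % M ≡ x) → (∀ t → toℕ t % M ≡ x → P (π ⟨$⟩ʳ t)) →
                     length (filter P? (allFin n)) ≡ k
  countViaResidues {n} k M n≡k*M π x x<M P? sound complete = begin
    length (filter P? (allFin n))                  ≡⟨ length-filter-tabulate P? (λ t → t) ⟩
    sum {n} (λ t → indicator (P? t))               ≡⟨ sum-permute (λ t → indicator (P? t)) π ⟩
    sum {n} (λ t → indicator (P? (π ⟨$⟩ʳ t)))      ≡⟨ sum-cong-≗ inResidueClass ⟩
    sum {n} (λ t → indicator (toℕ t % M ≟ x))      ≡⟨ sum≡rangeSum {n} (λ t → indicator (t % M ≟ x)) ⟩
    rangeSum (λ t → indicator (t % M ≟ x)) n       ≡⟨ cong (rangeSum (λ t → indicator (t % M ≟ x))) n≡k*M ⟩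
    rangeSum (λ t → indicator (t % M ≟ x)) (k * M) ≡⟨ residueCount M k x x<M ⟩
    k                                              ∎
    where
    open ≡-Reasoning
    inResidueClass : ∀ t → indicator (P? (π ⟨$⟩ʳ t)) ≡ indicator (toℕ t % M ≟ x)
    inResidueClass t = indicator-⇔ (P? (π ⟨$⟩ʳ t)) (toℕ t % M ≟ x) (sound t) (complete t)

module ZMod (v : ℕ) where
  open import Data.Nat using (ℕ; suc; _+_; _*_; _∸_; _≤_; _<_; z≤n; s≤s; _%_; _≤?_)
  open import Data.Nat.Properties
  open import Data.Nat.DivMod
  open import Data.Nat.Tactic.RingSolver using (solve-∀)
  open import Data.Empty using (⊥-elim)
  open import Data.Sum using (_⊎_; inj₁; inj₂)
  open import Data.Product using (_×_; _,_)
  open import Relation.Nullary using (yes; no)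
  open import Relation.Binary.Bundles using (Setoid)
  open import Relation.Binary.PropositionalEquality
  import Relation.Binary.Reasoning.Setoid as SetoidReasoning

  w : ℕ
  w = suc v

  m : ℕ
  m = suc (w + w)

  w<m : w < m
  w<m = s≤s (m≤m+n w w)

  -- Congruence modulo m.  A record, so that both sides stay inferable from a proof.
  infix 4 _≈_
  record _≈_ (x y : ℕ) : Set where
    constructor mod≡
    field residues : x % m ≡ y % m
  open _≈_ public

  ≈-setoid : Setoid _ _
  ≈-setoid = record
    { Carrier = ℕ ; _≈_ = _≈_
    ; isEquivalence = record
      { refl  = mod≡ refl
      ; sym   = λ (mod≡ p) → mod≡ (sym p)
      ; trans = λ (mod≡ p) (mod≡ q) → mod≡ (trans p q)
      } }

  open Setoid ≈-setoid public
    using () renaming (refl to ≈-refl; sym to ≈-sym; trans to ≈-trans; reflexive to ≡⇒≈)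
  module ≈-Reasoning = SetoidReasoning ≈-setoid

  ≈+ : ∀ {a b c d} → a ≈ b → c ≈ d → a + c ≈ b + d
  ≈+ {a} {b} {c} {d} (mod≡ p) (mod≡ q) = mod≡ (begin
    (a + c) % m             ≡⟨ %-distribˡ-+ a c m ⟩
    (a % m + c % m) % m     ≡⟨ cong₂ (λ x y → (x + y) % m) p q ⟩
    (b % m + d % m) % m     ≡⟨ %-distribˡ-+ b d m ⟨
    (b + d) % m             ∎)
    where open ≡-Reasoning

  ≈+ˡ : ∀ c {a b} → a ≈ b → c + a ≈ c + b
  ≈+ˡ c = ≈+ ≈-refl

  ≈+ʳ : ∀ c {a b} → a ≈ b → a + c ≈ b + c
  ≈+ʳ c p = ≈+ p ≈-refl

  ≈*ʳ : ∀ c {a b} → a ≈ b → a * c ≈ b * c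
  ≈*ʳ c {a} {b} (mod≡ p) = mod≡ (begin
    (a * c) % m              ≡⟨ %-distribˡ-* a c m ⟩
    (a % m * (c % m)) % m    ≡⟨ cong (λ x → (x * (c % m)) % m) p ⟩
    (b % m * (c % m)) % m    ≡⟨ %-distribˡ-* b c m ⟨
    (b * c) % m              ∎)
    where open ≡-Reasoning

  %≈ : ∀ x → x % m ≈ x
  %≈ x = mod≡ (m%n%n≡m%n x m)

  +k*m≈ : ∀ x k → x + k * m ≈ x
  +k*m≈ x k = mod≡ ([m+kn]%n≡m%n x k m)

  m≈0 : m ≈ 0
  m≈0 = mod≡ (n%n≡0 m)

  %<m : ∀ x → x % m < m
  %<m x = m%n<n x m

  ≈⇒≡ : ∀ {x y} → x < m → y < m → x ≈ y → x ≡ y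
  ≈⇒≡ x<m y<m (mod≡ p) = trans (sym (m<n⇒m%n≡m x<m)) (trans p (m<n⇒m%n≡m y<m))

  ≈⇒%≡ : ∀ {x y} → y < m → x ≈ y → x % m ≡ y
  ≈⇒%≡ y<m (mod≡ p) = trans p (m<n⇒m%n≡m y<m)

  ∸+≈0 : ∀ {d} → d ≤ m → (m ∸ d) + d ≈ 0
  ∸+≈0 d≤m = ≈-trans (≡⇒≈ (m∸n+n≡m d≤m)) m≈0

  +∸≈0 : ∀ {d} → d ≤ m → d + (m ∸ d) ≈ 0
  +∸≈0 {d} d≤m = ≈-trans (≡⇒≈ (+-comm d (m ∸ d))) (∸+≈0 d≤m)

  +neg≈0 : ∀ x → x + (m ∸ x % m) ≈ 0
  +neg≈0 x = ≈-trans (≈+ʳ (m ∸ x % m) (≈-sym (%≈ x))) (+∸≈0 (<⇒≤ (%<m x)))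

  cancelˡ : ∀ a {x y} → a + x ≈ a + y → x ≈ y
  cancelˡ a {x} {y} p = begin
    x                     ≡⟨ +-identityʳ x ⟨
    x + 0                 ≈⟨ ≈+ˡ x (+neg≈0 a) ⟨
    x + (a + a⁻)          ≡⟨ swap x a a⁻ ⟩
    a + x + a⁻            ≈⟨ ≈+ʳ a⁻ p ⟩
    a + y + a⁻            ≡⟨ swap y a a⁻ ⟨
    y + (a + a⁻)          ≈⟨ ≈+ˡ y (+neg≈0 a) ⟩
    y + 0                 ≡⟨ +-identityʳ y ⟩
    y                     ∎
    where
    open ≈-Reasoning
    a⁻ = m ∸ a % m
    swap : ∀ z a b → z + (a + b) ≡ a + z + b
    swap = solve-∀

  cancelʳ : ∀ a {x y} → x + a ≈ y + a → x ≈ y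
  cancelʳ a {x} {y} p = cancelˡ a (≈-trans (≡⇒≈ (+-comm a x)) (≈-trans p (≡⇒≈ (+-comm y a))))

  ≈-neg⇒≡ : ∀ {x d} → x < m → 0 < d → d ≤ m → x + d ≈ 0 → x ≡ m ∸ d
  ≈-neg⇒≡ x<m 0<d d≤m p = ≈⇒≡ x<m (∸-monoʳ-< 0<d d≤m) (cancelʳ _ (≈-trans p (≈-sym (∸+≈0 d≤m))))

  difference-neg : ∀ {u v c} → v < m → v ≈ u + c → u + (m ∸ v) + c ≈ 0
  difference-neg {u} {v} {c} v<m p = cancelʳ u (begin
    u + (m ∸ v) + c + u       ≡⟨ regroup u (m ∸ v) c ⟩
    u + ((m ∸ v) + (u + c))   ≈⟨ ≈+ˡ u (≈+ˡ (m ∸ v) p) ⟨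
    u + ((m ∸ v) + v)         ≈⟨ ≈+ˡ u (∸+≈0 (<⇒≤ v<m)) ⟩
    u + 0                     ≡⟨ +-comm u 0 ⟩
    0 + u                     ∎)
    where
    open ≈-Reasoning
    regroup : ∀ x y z → x + y + z + x ≡ x + (y + (x + z))
    regroup = solve-∀

  difference-pos : ∀ {u v c} → u < m → v ≈ u + c → v + (m ∸ u) ≈ c
  difference-pos {u} {v} {c} u<m p = begin
    v + (m ∸ u)           ≈⟨ ≈+ʳ (m ∸ u) p ⟩
    u + c + (m ∸ u)       ≡⟨ regroup u c (m ∸ u) ⟩
    c + (u + (m ∸ u))     ≈⟨ ≈+ˡ c (+∸≈0 (<⇒≤ u<m)) ⟩
    c + 0                 ≡⟨ +-identityʳ c ⟩
    c                     ∎
    where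
    open ≈-Reasoning
    regroup : ∀ x y z → x + y + z ≡ y + (x + z)
    regroup = solve-∀

  shift-≢ : ∀ {x y e} → 0 < e → e < m → y ≈ x + e → x ≢ y
  shift-≢ {x} {y} {e} 0<e e<m p refl = <⇒≢ 0<e (≈⇒≡ (s≤s z≤n) e<m (cancelˡ x (begin
    x + 0    ≡⟨ +-identityʳ x ⟩
    x        ≈⟨ p ⟩
    x + e    ∎)))
    where open ≈-Reasoning

  shift-back : ∀ {b} x y → b < m → x + y ≈ 0 → ((b + x) % m + y) % m ≡ b
  shift-back {b} x y b<m p = ≈⇒%≡ b<m (begin
    (b + x) % m + y     ≈⟨ ≈+ʳ y (%≈ (b + x)) ⟩
    b + x + y           ≡⟨ +-assoc b x y ⟩
    b + (x + y)         ≈⟨ ≈+ˡ b p ⟩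
    b + 0               ≡⟨ +-identityʳ b ⟩
    b                   ∎)
    where open ≈-Reasoning

  shift-unique : ∀ {b b' x c} → b < m → b' < m → (b + x) % m ≡ c → b' + x ≈ c → b ≡ b'
  shift-unique {b} {b'} {x} {c} b<m b'<m eq q = ≈⇒≡ b<m b'<m (cancelʳ x (begin
    b + x              ≈⟨ %≈ (b + x) ⟨
    (b + x) % m        ≡⟨ eq ⟩
    c                  ≈⟨ q ⟨
    b' + x             ∎))
    where open ≈-Reasoning

  -- Halving: since m is odd, 2 is invertible with inverse w+1.  Opaque, so that only the
  -- characterising properties below are used.
  opaque
    half : ℕ → ℕ
    half x = (x * suc w) % m

    half<m : ∀ x → half x < m
    half<m x = %<m (x * suc w)

    half-cong : ∀ {x y} → x ≈ y → half x ≡ half y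
    half-cong p = residues (≈*ʳ (suc w) p)

    half-double : ∀ x → half x + half x ≈ x
    half-double x = begin
      half x + half x             ≈⟨ ≈+ (%≈ (x * suc w)) (%≈ (x * suc w)) ⟩
      x * suc w + x * suc w       ≡⟨ twice x w ⟩
      x + x * m                   ≈⟨ +k*m≈ x x ⟩
      x                           ∎
      where
      open ≈-Reasoning
      twice : ∀ x w → x * suc w + x * suc w ≡ x + x * suc (w + w)
      twice = solve-∀

    half-of-double : ∀ y → half (y + y) ≈ y
    half-of-double y = begin
      half (y + y)                ≈⟨ %≈ ((y + y) * suc w) ⟩
      (y + y) * suc w             ≡⟨ doubled y w ⟩
      y + y * m                   ≈⟨ +k*m≈ y y ⟩
      y                           ∎
      where
      open ≈-Reasoning
      doubled : ∀ y w → (y + y) * suc w ≡ y + y * suc (w + w)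
      doubled = solve-∀

  half-of : ∀ {x y} → x ≈ y + y → half x ≈ y
  half-of {x} {y} p = ≈-trans (≡⇒≈ (half-cong p)) (half-of-double y)

  half-of≡ : ∀ {x y} → x ≈ y + y → half x ≡ y % m
  half-of≡ {x} {y} p = ≈⇒≡ (half<m x) (%<m y) (≈-trans (half-of p) (≈-sym (%≈ y)))

  half-of-neg : ∀ {x y} → x + (y + y) ≈ 0 → half x + y ≈ 0
  half-of-neg {x} {y} p = double-inj (begin
    half x + y + (half x + y)      ≡⟨ regroup (half x) y ⟩
    (half x + half x) + (y + y)    ≈⟨ ≈+ʳ (y + y) (half-double x) ⟩
    x + (y + y)                    ≈⟨ p ⟩
    0 + 0                          ∎)
    where
    open ≈-Reasoning
    regroup : ∀ a b → a + b + (a + b) ≡ (a + a) + (b + b)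
    regroup = solve-∀
    double-inj : ∀ {y z} → y + y ≈ z + z → y ≈ z
    double-inj {y} {z} q = ≈-trans (≈-sym (half-of-double y)) (≈-trans (≡⇒≈ (half-cong q)) (half-of-double z))

  w<m∸d : ∀ {d} → d ≤ w → w < m ∸ d
  w<m∸d {d} d≤w = ≤-trans (≤-reflexive (sym (m+n∸n≡m (suc w) w))) (∸-monoʳ-≤ m d≤w)

  m∸d≤w : ∀ {d} → w < d → m ∸ d ≤ w
  m∸d≤w {d} w<d = ≤-trans (∸-monoʳ-≤ m w<d) (≤-reflexive (m+n∸n≡m w w))

  opaque
    absₘ : ℕ → ℕ
    absₘ x = fold (x % m)
      where
      fold : ℕ → ℕ
      fold r with r ≤? w
      ... | yes _ = r
      ... | no  _ = m ∸ r

    absₘ-cases : ∀ x → (x % m ≤ w × absₘ x ≡ x % m) ⊎ (w < x % m × absₘ x ≡ m ∸ x % m)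
    absₘ-cases x with x % m ≤? w
    ... | yes r≤w = inj₁ (r≤w , refl)
    ... | no  r≰w = inj₂ (≰⇒> r≰w , refl)

  absₘ-pos : ∀ {x d} → d ≤ w → x ≈ d → absₘ x ≡ d
  absₘ-pos {x} {d} d≤w p with absₘ-cases x | ≈⇒%≡ (≤-<-trans d≤w w<m) p
  ... | inj₁ (_ , abs≡) | r≡d = trans abs≡ r≡d
  ... | inj₂ (w<r , _)  | r≡d = ⊥-elim (<⇒≱ w<r (subst (_≤ w) (sym r≡d) d≤w))

  absₘ-neg : ∀ {x d} → 0 < d → d ≤ w → x + d ≈ 0 → absₘ x ≡ d
  absₘ-neg {x} {d} 0<d d≤w p = byCases (absₘ-cases x)
    where
    d≤m : d ≤ m
    d≤m = ≤-trans d≤w (<⇒≤ w<m)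
    r≡m∸d : x % m ≡ m ∸ d
    r≡m∸d = ≈-neg⇒≡ (%<m x) 0<d d≤m (≈-trans (≈+ʳ d (%≈ x)) p)
    byCases : (x % m ≤ w × absₘ x ≡ x % m) ⊎ (w < x % m × absₘ x ≡ m ∸ x % m) → absₘ x ≡ d
    byCases (inj₁ (r≤w , _))  = ⊥-elim (<⇒≱ (w<m∸d d≤w) (subst (_≤ w) r≡m∸d r≤w))
    byCases (inj₂ (_ , abs≡)) = trans abs≡ (trans (cong (m ∸_) r≡m∸d) (m∸[m∸n]≡n d≤m))

  absₘ-bounds : ∀ {x} → x < m → 0 < x → 0 < absₘ x × absₘ x ≤ w
  absₘ-bounds {x} x<m 0<x with absₘ-cases x | m<n⇒m%n≡m x<m
  ... | inj₁ (r≤w , abs≡) | r≡x = subst (0 <_) (sym (trans abs≡ r≡x)) 0<x , subst (_≤ w) (sym abs≡) r≤w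
  ... | inj₂ (w<r , abs≡) | _   = subst (0 <_) (sym abs≡) (m<n⇒0<n∸m (%<m x)) ,
                                  subst (_≤ w) (sym abs≡) (m∸d≤w w<r)

  absₘ-inv : ∀ {x d} → absₘ x ≡ d → x ≈ d ⊎ x + d ≈ 0
  absₘ-inv {x} refl with absₘ-cases x
  ... | inj₁ (_ , abs≡) = inj₁ (≈-trans (≈-sym (%≈ x)) (≡⇒≈ (sym abs≡)))
  ... | inj₂ (_ , abs≡) = inj₂ (≈-trans (≡⇒≈ (cong (x +_) abs≡)) (+neg≈0 x))

module Blocks (v : ℕ) where
  open import Data.Nat using (ℕ; suc; pred; _+_; _∸_; _≤_; _<_; z≤n; s≤s; _%_; _≟_; _≤?_)
  open import Data.Nat.Properties
  open import Data.Nat.Tactic.RingSolver using (solve-∀)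
  open import Data.Empty using (⊥-elim)
  open import Data.Unit using (⊤; tt)
  open import Data.Sum using (_⊎_; inj₁; inj₂)
  open import Data.Product using (_×_; _,_; proj₁; proj₂)
  open import Data.Fin using (Fin; opposite)
  open import Function using (_∘_)
  open import Data.Fin.Patterns using (0F; 1F; 2F)
  open import Relation.Nullary using (¬_; Dec; yes; no)
  open import Relation.Binary.PropositionalEquality
  open ZMod v public

  -- Case distinction on a decision.  Unlike `if does _`, it does not reduce before the decision
  -- is known, so proofs can split on the decision itself with `with`.
  if?_then_else_ : ∀ {p a} {P : Set p} {A : Set a} → Dec P → A → A → A
  if? yes _ then x else _ = x
  if? no _  then _ else y = y

  Layer : Set
  Layer = Fin 3

  next : Layer → Layer
  next 0F = 1F
  next 1F = 2F
  next 2F = 0F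

  Point : Set
  Point = ℕ × Layer

  OffOrigin : ℕ → Layer → Set
  OffOrigin a 0F = a ≢ 0
  OffOrigin a _  = ⊤

  record IsPoint (p : Point) : Set where
    constructor mkPoint
    field
      residue<m : proj₁ p < m
      offOrigin : OffOrigin (proj₁ p) (proj₂ p)
  open IsPoint public

  -- A triple is indexed by j < w (its difference is d = j+1) and a point (a , i), its first entry.
  Index : Set
  Index = ℕ × Point

  record IsIndex (x : Index) : Set where
    constructor mkIndex
    field
      columnBound : proj₁ x < w
      firstPoint  : IsPoint (proj₂ x)
  open IsIndex public

  twoD negTwoD : ℕ → ℕ
  twoD j = suc j + suc j
  negTwoD j = m ∸ twoD j

  shift : ℕ → Layer → ℕ
  shift j 2F = negTwoD j
  shift j _  = suc j

  module _ {j : ℕ} (j<w : j < w) where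
    twoD<m : twoD j < m
    twoD<m = s≤s (+-mono-≤ j<w j<w)

    negTwoD+twoD≈0 : negTwoD j + twoD j ≈ 0
    negTwoD+twoD≈0 = ∸+≈0 (<⇒≤ twoD<m)

    negTwoD<m : negTwoD j < m
    negTwoD<m = ∸-monoʳ-< (s≤s z≤n) (<⇒≤ twoD<m)

    0<negTwoD : 0 < negTwoD j
    0<negTwoD = m<n⇒0<n∸m twoD<m

    0<shift : ∀ i → 0 < shift j i
    0<shift 0F = s≤s z≤n
    0<shift 1F = s≤s z≤n
    0<shift 2F = 0<negTwoD

    shift<m : ∀ i → shift j i < m
    shift<m 0F = ≤-<-trans j<w w<m
    shift<m 1F = ≤-<-trans j<w w<m
    shift<m 2F = negTwoD<m

    twoD+negTwoD≈0 : twoD j + negTwoD j ≈ 0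
    twoD+negTwoD≈0 = ≈-trans (≡⇒≈ (+-comm (twoD j) (negTwoD j))) negTwoD+twoD≈0

  -- The two triples which would contain the origin, (d, -2d, 0) and (d, 2d, 2), are replaced
  -- by vertical triples {(a,0), (a,1), (a,2)}.
  data Kind : Set where
    generic vertical : Kind

  kind : ℕ → Point → Kind
  kind j (a , 0F) = if? a ≟ negTwoD j then vertical else generic
  kind j (a , 1F) = generic
  kind j (a , 2F) = if? a ≟ twoD j then vertical else generic

  -- The layer of entry k of the vertical triple through (a , i), for i ∈ {0, 2}.
  verticalLayer : Layer → Fin 3 → Layer
  verticalLayer i 0F = i
  verticalLayer i 1F = opposite i
  verticalLayer i 2F = 1F

  entryOf : Kind → ℕ → Point → Fin 3 → Point
  entryOf generic  j (a , i) 0F = (a , i)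
  entryOf generic  j (a , i) 1F = ((a + (shift j i + shift j i)) % m , i)
  entryOf generic  j (a , i) 2F = ((a + shift j i) % m , next i)
  entryOf vertical j (a , i) k  = (a , verticalLayer i k)

  block : Index → Fin 3 → Point
  block (j , p) = entryOf (kind j p) j p

  kindOf : Index → Kind
  kindOf (j , p) = kind j p

  residueOf : Index → ℕ
  residueOf (_ , a , _) = a

  data KindView (j a : ℕ) : Layer → Kind → Set where
    generic₀  : a ≢ negTwoD j → KindView j a 0F generic
    vertical₀ : a ≡ negTwoD j → KindView j a 0F vertical
    generic₁  : KindView j a 1F generic
    generic₂  : a ≢ twoD j → KindView j a 2F generic
    vertical₂ : a ≡ twoD j → KindView j a 2F vertical

  kindView : ∀ j a i → KindView j a i (kind j (a , i))
  kindView j a 0F with a ≟ negTwoD j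
  ... | yes p = vertical₀ p
  ... | no ¬p = generic₀ ¬p
  kindView j a 1F = generic₁
  kindView j a 2F with a ≟ twoD j
  ... | yes p = vertical₂ p
  ... | no ¬p = generic₂ ¬p

  kind-vertical₀ : ∀ {j a} → a ≡ negTwoD j → kind j (a , 0F) ≡ vertical
  kind-vertical₀ {j} {a} a≡ with a ≟ negTwoD j
  ... | yes _  = refl
  ... | no a≢ = ⊥-elim (a≢ a≡)

  kind-vertical₂ : ∀ {j a} → a ≡ twoD j → kind j (a , 2F) ≡ vertical
  kind-vertical₂ {j} {a} a≡ with a ≟ twoD j
  ... | yes _  = refl
  ... | no a≢ = ⊥-elim (a≢ a≡)

  kind-generic₀ : ∀ {j a} → a ≢ negTwoD j → kind j (a , 0F) ≡ generic
  kind-generic₀ {j} {a} a≢ with a ≟ negTwoD j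
  ... | yes a≡ = ⊥-elim (a≢ a≡)
  ... | no _   = refl

  kind-generic₂ : ∀ {j a} → a ≢ twoD j → kind j (a , 2F) ≡ generic
  kind-generic₂ {j} {a} a≢ with a ≟ twoD j
  ... | yes a≡ = ⊥-elim (a≢ a≡)
  ... | no _   = refl

  block-first : ∀ x → block x 0F ≡ proj₂ x
  block-first (j , a , i) with kind j (a , i)
  ... | generic  = refl
  ... | vertical = refl

  block-isPoint : ∀ {x} → IsIndex x → ∀ k → IsPoint (block x k)
  block-isPoint {j , a , i} (mkIndex j<w p@(mkPoint a<m _)) k with kind j (a , i) | kindView j a i | k
  ... | generic  | _ | 0F = p
  ... | vertical | _ | 0F = p
  ... | .generic | generic₀ a≢ | 1F = mkPoint (%<m (a + twoD j))
                                        (λ r≡0 → a≢ (shift-unique a<m (negTwoD<m j<w) r≡0 (negTwoD+twoD≈0 j<w)))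
  ... | .generic | generic₀ _ | 2F = mkPoint (%<m (a + suc j)) tt
  ... | .generic | generic₁ | 1F = mkPoint (%<m (a + twoD j)) tt
  ... | .generic | generic₁ | 2F = mkPoint (%<m (a + suc j)) tt
  ... | .generic | generic₂ _ | 1F = mkPoint (%<m (a + (negTwoD j + negTwoD j))) tt
  ... | .generic | generic₂ a≢ | 2F = mkPoint (%<m (a + negTwoD j))
                                        (λ r≡0 → a≢ (shift-unique a<m (twoD<m j<w) r≡0 (twoD+negTwoD≈0 j<w)))
  ... | .vertical | vertical₀ _ | 1F = mkPoint a<m tt
  ... | .vertical | vertical₀ _ | 2F = mkPoint a<m tt
  ... | .vertical | vertical₂ a≡ | 1F = mkPoint a<m (λ a≡0 → 0≢1+n (trans (sym a≡0) a≡))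
  ... | .vertical | vertical₂ _ | 2F = mkPoint a<m tt

  -- Keys.  A vertical triple is identified by its residue, a generic one by its layer i,
  -- the residue a+e of its last entry and its difference d.
  Key : Set
  Key = ℕ ⊎ (Layer × ℕ × ℕ)

  keyOf : Kind → Index → Key
  keyOf generic  (j , a , i) = inj₂ (i , (a + shift j i) % m , suc j)
  keyOf vertical (j , a , i) = inj₁ a

  blockKey : Index → Key
  blockKey x = keyOf (kindOf x) x

  -- Recovering d from the difference ±e of two points of a generic triple in layer i.
  reduce : Layer → ℕ → ℕ
  reduce 2F x = absₘ (half x)
  reduce _  x = absₘ x

  sameLayerKey : Layer → ℕ → ℕ → Key
  sameLayerKey i u v = inj₂ (i , half (u + v) , reduce i (half (u + (m ∸ v))))

  -- The key of u in layer i and z in the next layer: u itself if the residues agree (the pair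
  -- lies in a vertical triple), otherwise z and the reduced difference.
  crossKey : Layer → ℕ → ℕ → Key
  crossKey i u z = if? u ≟ z then inj₁ u else inj₂ (i , z , reduce i (u + (m ∸ z)))

  pairKey : Point → Point → Key
  pairKey (u , 0F) (v , 0F) = sameLayerKey 0F u v
  pairKey (u , 1F) (v , 1F) = sameLayerKey 1F u v
  pairKey (u , 2F) (v , 2F) = sameLayerKey 2F u v
  pairKey (u , 0F) (v , 1F) = crossKey 0F u v
  pairKey (u , 1F) (v , 2F) = crossKey 1F u v
  pairKey (u , 2F) (v , 0F) = crossKey 2F u v
  pairKey (u , 1F) (v , 0F) = crossKey 0F v u
  pairKey (u , 2F) (v , 1F) = crossKey 1F v u
  pairKey (u , 0F) (v , 2F) = crossKey 2F v u

  pairKey-same : ∀ i u v → pairKey (u , i) (v , i) ≡ sameLayerKey i u v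
  pairKey-same 0F u v = refl
  pairKey-same 1F u v = refl
  pairKey-same 2F u v = refl

  pairKey-up : ∀ i u z → pairKey (u , i) (z , next i) ≡ crossKey i u z
  pairKey-up 0F u z = refl
  pairKey-up 1F u z = refl
  pairKey-up 2F u z = refl

  pairKey-down : ∀ i u z → pairKey (z , next i) (u , i) ≡ crossKey i u z
  pairKey-down 0F u z = refl
  pairKey-down 1F u z = refl
  pairKey-down 2F u z = refl

  crossKey-self : ∀ i u → crossKey i u u ≡ inj₁ u
  crossKey-self i u with u ≟ u
  ... | yes _  = refl
  ... | no u≢u = ⊥-elim (u≢u refl)

  crossKey-distinct : ∀ i {u z} → u ≢ z → crossKey i u z ≡ inj₂ (i , z , reduce i (u + (m ∸ z)))
  crossKey-distinct i {u} {z} u≢z with u ≟ z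
  ... | yes u≡z = ⊥-elim (u≢z u≡z)
  ... | no _    = refl

  pairKey-vertical : ∀ a {i i'} → i ≢ i' → pairKey (a , i) (a , i') ≡ inj₁ a
  pairKey-vertical a {0F} {0F} i≢i' = ⊥-elim (i≢i' refl)
  pairKey-vertical a {1F} {1F} i≢i' = ⊥-elim (i≢i' refl)
  pairKey-vertical a {2F} {2F} i≢i' = ⊥-elim (i≢i' refl)
  pairKey-vertical a {0F} {1F} _ = crossKey-self 0F a
  pairKey-vertical a {1F} {2F} _ = crossKey-self 1F a
  pairKey-vertical a {2F} {0F} _ = crossKey-self 2F a
  pairKey-vertical a {1F} {0F} _ = crossKey-self 0F a
  pairKey-vertical a {2F} {1F} _ = crossKey-self 1F a
  pairKey-vertical a {0F} {2F} _ = crossKey-self 2F a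

  module _ {j : ℕ} (j<w : j < w) where
    reduce-shift : ∀ i {x} → x ≈ shift j i → reduce i x ≡ suc j
    reduce-shift 0F p = absₘ-pos j<w p
    reduce-shift 1F p = absₘ-pos j<w p
    reduce-shift 2F p = absₘ-neg (s≤s z≤n) j<w (half-of-neg (≈-trans (≈+ʳ (twoD j) p) (negTwoD+twoD≈0 j<w)))

    reduce-negShift : ∀ i {x} → x + shift j i ≈ 0 → reduce i x ≡ suc j
    reduce-negShift 0F p = absₘ-neg (s≤s z≤n) j<w p
    reduce-negShift 1F p = absₘ-neg (s≤s z≤n) j<w p
    reduce-negShift 2F p = absₘ-pos j<w (half-of (cancelʳ (negTwoD j) (≈-trans p (≈-sym (twoD+negTwoD≈0 j<w)))))

  module _ {j a : ℕ} (i : Layer) (j<w : j < w) (a<m : a < m) where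
    private
      e = shift j i
      V = (a + (e + e)) % m
      Z = (a + e) % m
      key : Key
      key = inj₂ (i , Z , suc j)

      V≈a+2e : V ≈ a + (e + e)
      V≈a+2e = %≈ (a + (e + e))

      Z≈a+e : Z ≈ a + e
      Z≈a+e = %≈ (a + e)

      V≈Z+e : V ≈ Z + e
      V≈Z+e = ≈-trans V≈a+2e (≈-trans (≡⇒≈ (sym (+-assoc a e e))) (≈+ʳ e (≈-sym Z≈a+e)))

      midpoint : ∀ {s} → s ≈ (a + e) + (a + e) → half s ≡ Z
      midpoint = half-of≡ {y = a + e}

      a+V≈ : a + V ≈ (a + e) + (a + e)
      a+V≈ = ≈-trans (≈+ˡ a V≈a+2e) (≡⇒≈ (regroup a e))
        where
        regroup : ∀ a e → a + (a + (e + e)) ≡ (a + e) + (a + e)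
        regroup = solve-∀

      sameKey₀₁ : sameLayerKey i a V ≡ key
      sameKey₀₁ = cong₂ (λ s r → inj₂ (i , s , r)) (midpoint a+V≈)
                        (reduce-negShift j<w i (half-of-neg (difference-neg {u = a} (%<m (a + (e + e))) V≈a+2e)))

      sameKey₁₀ : sameLayerKey i V a ≡ key
      sameKey₁₀ = cong₂ (λ s r → inj₂ (i , s , r)) (midpoint (≈-trans (≡⇒≈ (+-comm V a)) a+V≈))
                        (reduce-shift j<w i (half-of (difference-pos a<m V≈a+2e)))

      crossKey₀₂ : crossKey i a Z ≡ key
      crossKey₀₂ = trans (crossKey-distinct i (shift-≢ (0<shift j<w i) (shift<m j<w i) Z≈a+e))
                         (cong (λ r → inj₂ (i , Z , r))
                               (reduce-negShift j<w i (difference-neg {u = a} (%<m (a + e)) Z≈a+e)))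

      crossKey₁₂ : crossKey i V Z ≡ key
      crossKey₁₂ = trans (crossKey-distinct i (≢-sym (shift-≢ (0<shift j<w i) (shift<m j<w i) V≈Z+e)))
                         (cong (λ r → inj₂ (i , Z , r)) (reduce-shift j<w i (difference-pos (%<m (a + e)) V≈Z+e)))

    generic-pairKey : ∀ k l → k ≢ l →
                      pairKey (entryOf generic j (a , i) k) (entryOf generic j (a , i) l) ≡ keyOf generic (j , a , i)
    generic-pairKey 0F 0F k≢l = ⊥-elim (k≢l refl)
    generic-pairKey 1F 1F k≢l = ⊥-elim (k≢l refl)
    generic-pairKey 2F 2F k≢l = ⊥-elim (k≢l refl)
    generic-pairKey 0F 1F _ = trans (pairKey-same i a V) sameKey₀₁
    generic-pairKey 1F 0F _ = trans (pairKey-same i V a) sameKey₁₀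
    generic-pairKey 0F 2F _ = trans (pairKey-up i a Z) crossKey₀₂
    generic-pairKey 2F 0F _ = trans (pairKey-down i a Z) crossKey₀₂
    generic-pairKey 1F 2F _ = trans (pairKey-up i V Z) crossKey₁₂
    generic-pairKey 2F 1F _ = trans (pairKey-down i V Z) crossKey₁₂

  verticalLayer-injective : ∀ {i} → i ≢ 1F → ∀ k l → verticalLayer i k ≡ verticalLayer i l → k ≡ l
  verticalLayer-injective {1F} i≢1F _  _  _ = ⊥-elim (i≢1F refl)
  verticalLayer-injective {0F} _ 0F 0F _ = refl
  verticalLayer-injective {0F} _ 1F 1F _ = refl
  verticalLayer-injective {0F} _ 2F 2F _ = refl
  verticalLayer-injective {0F} _ 0F 1F ()
  verticalLayer-injective {0F} _ 0F 2F ()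
  verticalLayer-injective {0F} _ 1F 0F ()
  verticalLayer-injective {0F} _ 1F 2F ()
  verticalLayer-injective {0F} _ 2F 0F ()
  verticalLayer-injective {0F} _ 2F 1F ()
  verticalLayer-injective {2F} _ 0F 0F _ = refl
  verticalLayer-injective {2F} _ 1F 1F _ = refl
  verticalLayer-injective {2F} _ 2F 2F _ = refl
  verticalLayer-injective {2F} _ 0F 1F ()
  verticalLayer-injective {2F} _ 0F 2F ()
  verticalLayer-injective {2F} _ 1F 0F ()
  verticalLayer-injective {2F} _ 1F 2F ()
  verticalLayer-injective {2F} _ 2F 0F ()
  verticalLayer-injective {2F} _ 2F 1F ()

  block-pairKey : ∀ {x} → IsIndex x → ∀ k l → k ≢ l → pairKey (block x k) (block x l) ≡ blockKey x
  block-pairKey {j , a , i} (mkIndex j<w p) k l k≢l with kind j (a , i) | kindView j a i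
  ... | .generic  | generic₀ _  = generic-pairKey 0F j<w (residue<m p) k l k≢l
  ... | .generic  | generic₁    = generic-pairKey 1F j<w (residue<m p) k l k≢l
  ... | .generic  | generic₂ _  = generic-pairKey 2F j<w (residue<m p) k l k≢l
  ... | .vertical | vertical₀ _ = pairKey-vertical a (k≢l ∘ verticalLayer-injective (λ ()) k l)
  ... | .vertical | vertical₂ _ = pairKey-vertical a (k≢l ∘ verticalLayer-injective (λ ()) k l)

  -- Entries of a triple are distinct: the key of a pair (p , p) has reduced difference 0,
  -- which no triple has.
  reduce-zero : ∀ i {x} → x ≈ 0 → reduce i x ≡ 0
  reduce-zero 0F p = absₘ-pos z≤n p
  reduce-zero 1F p = absₘ-pos z≤n p
  reduce-zero 2F p = absₘ-pos z≤n (half-of p)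

  diagonalKey : ∀ {u} i → u < m → pairKey (u , i) (u , i) ≡ inj₂ (i , half (u + u) , 0)
  diagonalKey {u} i u<m = trans (pairKey-same i u u)
    (cong (λ r → inj₂ (i , half (u + u) , r)) (reduce-zero i (half-of (+∸≈0 (<⇒≤ u<m)))))

  blockKey≢diagonal : ∀ x {i s} → blockKey x ≢ inj₂ (i , s , 0)
  blockKey≢diagonal (j , a , i) with kind j (a , i)
  ... | generic  = λ ()
  ... | vertical = λ ()

  block-distinct : ∀ {x} → IsIndex x → ∀ k l → k ≢ l → block x k ≢ block x l
  block-distinct {x} X k l k≢l eq = blockKey≢diagonal x (begin
    blockKey x                          ≡⟨ block-pairKey X k l k≢l ⟨
    pairKey (block x k) (block x l)     ≡⟨ cong (pairKey (block x k)) eq ⟨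
    pairKey (u , i) (u , i)             ≡⟨ diagonalKey i (residue<m (block-isPoint X k)) ⟩
    inj₂ (i , half (u + u) , 0)         ∎)
    where
    open ≡-Reasoning
    u = proj₁ (block x k)
    i = proj₂ (block x k)

  module _ {j : ℕ} (j<w : j < w) where
    half-twoD : half (twoD j) ≡ suc j
    half-twoD = ≈⇒≡ (half<m _) (≤-<-trans j<w w<m) (half-of {y = suc j} ≈-refl)

    half-negTwoD : half (negTwoD j) ≡ m ∸ suc j
    half-negTwoD = ≈-neg⇒≡ (half<m _) (s≤s z≤n) (≤-trans j<w (<⇒≤ w<m))
                     (half-of-neg (negTwoD+twoD≈0 j<w))

  -- The vertical triple with residue b ≠ 0: b = 2d in layer 2 when half b = d ≤ w, and
  -- b = -2d in layer 0 when half b = -d.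
  verticalIndex : ℕ → Index
  verticalIndex b = if? half b ≤? w then (pred (half b) , b , 2F) else (pred (m ∸ half b) , b , 0F)

  verticalIndex-layer₂ : ∀ {b} → half b ≤ w → verticalIndex b ≡ (pred (half b) , b , 2F)
  verticalIndex-layer₂ {b} le with half b ≤? w
  ... | yes _  = refl
  ... | no ¬le = ⊥-elim (¬le le)

  verticalIndex-layer₀ : ∀ {b} → ¬ half b ≤ w → verticalIndex b ≡ (pred (m ∸ half b) , b , 0F)
  verticalIndex-layer₀ {b} ¬le with half b ≤? w
  ... | yes le = ⊥-elim (¬le le)
  ... | no _   = refl

  verticalIndex-complete : ∀ {x} → IsIndex x → kindOf x ≡ vertical → verticalIndex (residueOf x) ≡ x
  verticalIndex-complete {j , a , i} (mkIndex j<w p) with kind j (a , i) | kindView j a i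
  ... | .generic  | generic₀ _  = λ ()
  ... | .generic  | generic₁    = λ ()
  ... | .generic  | generic₂ _  = λ ()
  ... | .vertical | vertical₂ a≡ = λ _ →
    trans (verticalIndex-layer₂ (subst (_≤ w) (sym half≡) j<w)) (cong (λ y → (pred y , a , 2F)) half≡)
    where
    half≡ : half a ≡ suc j
    half≡ = trans (cong half a≡) (half-twoD j<w)
  ... | .vertical | vertical₀ a≡ = λ _ →
    trans (verticalIndex-layer₀ (λ le → <⇒≱ (w<m∸d j<w) (subst (_≤ w) half≡ le)))
          (cong (λ y → (pred y , a , 0F)) (trans (cong (m ∸_) half≡) (m∸[m∸n]≡n (≤-trans j<w (<⇒≤ w<m)))))
    where
    half≡ : half a ≡ m ∸ suc j
    half≡ = trans (cong half a≡) (half-negTwoD j<w)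

  decodeKey : Key → Index
  decodeKey (inj₁ a)           = verticalIndex a
  decodeKey (inj₂ (i , s , d)) = (pred d , (s + (m ∸ shift (pred d) i)) % m , i)

  decodeKey-blockKey : ∀ {x} → IsIndex x → decodeKey (blockKey x) ≡ x
  decodeKey-blockKey {j , a , i} X@(mkIndex j<w p) with kind j (a , i) in kind≡
  ... | generic  = cong (λ a' → (j , a' , i))
                        (shift-back (shift j i) (m ∸ shift j i) (residue<m p) (+∸≈0 (<⇒≤ (shift<m j<w i))))
  ... | vertical = verticalIndex-complete X kind≡

  blockKey-injective : ∀ {x y} → IsIndex x → IsIndex y → blockKey x ≡ blockKey y → x ≡ y
  blockKey-injective {x} {y} X Y eq = begin
    x                       ≡⟨ decodeKey-blockKey X ⟨
    decodeKey (blockKey x)  ≡⟨ cong decodeKey eq ⟩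
    decodeKey (blockKey y)  ≡⟨ decodeKey-blockKey Y ⟩
    y                       ∎
    where open ≡-Reasoning

  blocks-sharing-pair : ∀ {x y} → IsIndex x → IsIndex y → ∀ {k l k' l'} → k ≢ l → k' ≢ l' →
                        block x k ≡ block y k' → block x l ≡ block y l' → x ≡ y
  blocks-sharing-pair {x} {y} X Y {k} {l} {k'} {l'} k≢l k'≢l' eqₖ eqₗ = blockKey-injective X Y (begin
    blockKey x                            ≡⟨ block-pairKey X k l k≢l ⟨
    pairKey (block x k) (block x l)       ≡⟨ cong₂ pairKey eqₖ eqₗ ⟩
    pairKey (block y k') (block y l')     ≡⟨ block-pairKey Y k' l' k'≢l' ⟩
    blockKey y                            ∎)
    where open ≡-Reasoning

module Balance (v : ℕ) where
  open import Data.Nat using (ℕ; suc; pred; _+_; _∸_; _≤_; _<_; z≤n; s≤s; _%_; _≟_; _≤?_; ≢-nonZero; >-nonZero)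
  open import Data.Nat.Properties
  open import Data.Nat.Tactic.RingSolver using (solve-∀)
  open import Data.Empty using (⊥; ⊥-elim)
  open import Data.Unit using (tt)
  open import Data.Product using (_×_; _,_; proj₁; proj₂)
  open import Data.Sum using (_⊎_; inj₁; inj₂)
  open import Data.Fin using (Fin)
  open import Data.Fin.Patterns using (0F; 1F; 2F)
  open import Relation.Nullary using (¬_; yes; no)
  open import Relation.Binary.PropositionalEquality
  open Blocks v public

  -- Position k is balanced if, for some assignment of columns < w to the triples, the map
  -- x ↦ (column x , block x k) is a bijection of the index set; its inverse is `source`.
  record Balanced (k : Fin 3) : Set where
    field
      column         : Index → ℕ
      source         : Index → Index
      column<w       : ∀ {x} → IsIndex x → column x < w
      source-isIndex : ∀ {y} → IsIndex y → IsIndex (source y)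
      target-source  : ∀ {y} → IsIndex y → (column (source y) , block (source y) k) ≡ y
      source-target  : ∀ {x} → IsIndex x → source (column x , block x k) ≡ x

  -- Position 0: every triple starts at the point it is indexed by.
  balanced₀ : Balanced 0F
  balanced₀ = record
    { column         = proj₁
    ; source         = λ y → y
    ; column<w       = IsIndex.columnBound
    ; source-isIndex = λ Y → Y
    ; target-source  = λ {(j , p)} _ → cong (j ,_) (block-first (j , p))
    ; source-target  = λ {(j , p)} _ → cong (j ,_) (block-first (j , p))
    }

  source₁ : ℕ → Point → Point
  source₁ j (b , 0F) = if? b ≟ twoD j then (b , 2F) else ((b + negTwoD j) % m , 0F)
  source₁ j (b , 1F) = ((b + negTwoD j) % m , 1F)
  source₁ j (b , 2F) = if? b ≟ negTwoD j then (b , 0F) else ((b + (twoD j + twoD j)) % m , 2F)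

  module _ {j : ℕ} (j<w : j < w) where
    private
      fourD+2negTwoD≈0 : (twoD j + twoD j) + (negTwoD j + negTwoD j) ≈ 0
      fourD+2negTwoD≈0 = ≈-trans (≡⇒≈ (regroup (twoD j) (negTwoD j)))
                                 (≈+ (twoD+negTwoD≈0 j<w) (twoD+negTwoD≈0 j<w))
        where
        regroup : ∀ x y → (x + x) + (y + y) ≡ (x + y) + (x + y)
        regroup = solve-∀

      2negTwoD+fourD≈0 : (negTwoD j + negTwoD j) + (twoD j + twoD j) ≈ 0
      2negTwoD+fourD≈0 = ≈-trans (≡⇒≈ (+-comm (negTwoD j + negTwoD j) _)) fourD+2negTwoD≈0

    source₁-sound : ∀ {p} → IsPoint p → IsIndex (j , source₁ j p) × block (j , source₁ j p) 1F ≡ p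
    source₁-sound {b , 0F} (mkPoint b<m b≢0) with b ≟ twoD j
    ... | yes b≡ = mkIndex j<w (mkPoint b<m tt) , cong (λ κ → entryOf κ j (b , 2F) 1F) (kind-vertical₂ {j} b≡)
    ... | no b≢  = mkIndex j<w (mkPoint (%<m (b + negTwoD j)) a≢0) ,
                   trans (cong (λ κ → entryOf κ j (a , 0F) 1F) (kind-generic₀ {j} a≢negTwoD))
                         (cong (_, 0F) (shift-back (negTwoD j) (twoD j) b<m (negTwoD+twoD≈0 j<w)))
      where
      a = (b + negTwoD j) % m
      a≢0 : a ≢ 0
      a≢0 a≡0 = b≢ (shift-unique b<m (twoD<m j<w) a≡0 (twoD+negTwoD≈0 j<w))
      a≢negTwoD : a ≢ negTwoD j
      a≢negTwoD a≡ = b≢0 (shift-unique b<m (s≤s z≤n) a≡ ≈-refl)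
    source₁-sound {b , 1F} (mkPoint b<m _) =
      mkIndex j<w (mkPoint (%<m (b + negTwoD j)) tt) , cong (_, 1F) (shift-back (negTwoD j) (twoD j) b<m (negTwoD+twoD≈0 j<w))
    source₁-sound {b , 2F} (mkPoint b<m _) with b ≟ negTwoD j
    ... | yes b≡ = mkIndex j<w (mkPoint b<m (λ b≡0 → <⇒≢ (0<negTwoD j<w) (trans (sym b≡0) b≡))) ,
                   cong (λ κ → entryOf κ j (b , 0F) 1F) (kind-vertical₀ {j} b≡)
    ... | no b≢  = mkIndex j<w (mkPoint (%<m (b + (twoD j + twoD j))) tt) ,
                   trans (cong (λ κ → entryOf κ j (a , 2F) 1F) (kind-generic₂ {j} a≢twoD))
                         (cong (_, 2F) (shift-back (twoD j + twoD j) _ b<m fourD+2negTwoD≈0))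
      where
      a = (b + (twoD j + twoD j)) % m
      a≢twoD : a ≢ twoD j
      a≢twoD a≡ = b≢ (shift-unique b<m (negTwoD<m j<w) a≡ (begin
        negTwoD j + (twoD j + twoD j)   ≡⟨ +-assoc (negTwoD j) (twoD j) (twoD j) ⟨
        negTwoD j + twoD j + twoD j     ≈⟨ ≈+ʳ (twoD j) (negTwoD+twoD≈0 j<w) ⟩
        twoD j                          ∎))
        where open ≈-Reasoning

    source₁-block : ∀ {a i} → IsPoint (a , i) → source₁ j (block (j , a , i) 1F) ≡ (a , i)
    source₁-block {a} {i} (mkPoint a<m p) with kind j (a , i) | kindView j a i
    ... | .generic | generic₀ _ with (a + twoD j) % m ≟ twoD j
    ...   | yes r≡ = ⊥-elim (p (shift-unique a<m (s≤s z≤n) r≡ ≈-refl))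
    ...   | no _   = cong (_, 0F) (shift-back (twoD j) (negTwoD j) a<m (twoD+negTwoD≈0 j<w))
    source₁-block (mkPoint a<m _) | .generic | generic₁ =
      cong (_, 1F) (shift-back (twoD j) (negTwoD j) a<m (twoD+negTwoD≈0 j<w))
    source₁-block {a} (mkPoint a<m _) | .generic | generic₂ a≢ with (a + (negTwoD j + negTwoD j)) % m ≟ negTwoD j
    ...   | yes r≡ = ⊥-elim (a≢ (shift-unique a<m (twoD<m j<w) r≡ (begin
        twoD j + (negTwoD j + negTwoD j)   ≡⟨ +-assoc (twoD j) (negTwoD j) (negTwoD j) ⟨
        twoD j + negTwoD j + negTwoD j     ≈⟨ ≈+ʳ (negTwoD j) (twoD+negTwoD≈0 j<w) ⟩
        negTwoD j                          ∎)))
      where open ≈-Reasoning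
    ...   | no _   = cong (_, 2F) (shift-back (negTwoD j + negTwoD j) (twoD j + twoD j) a<m 2negTwoD+fourD≈0)
    source₁-block {a} _ | .vertical | vertical₀ a≡ with a ≟ negTwoD j
    ...   | yes _  = refl
    ...   | no a≢  = ⊥-elim (a≢ a≡)
    source₁-block {a} _ | .vertical | vertical₂ a≡ with a ≟ twoD j
    ...   | yes _  = refl
    ...   | no a≢  = ⊥-elim (a≢ a≡)

  balanced₁ : Balanced 1F
  balanced₁ = record
    { column         = proj₁
    ; source         = λ (j , p) → (j , source₁ j p)
    ; column<w       = IsIndex.columnBound
    ; source-isIndex = λ (mkIndex j<w P) → proj₁ (source₁-sound j<w P)
    ; target-source  = λ {(j , p)} (mkIndex j<w P) → cong (j ,_) (proj₂ (source₁-sound j<w P))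
    ; source-target  = λ {(j , p)} (mkIndex j<w P) → cong (j ,_) (source₁-block j<w P)
    }


  -- Position 2.  The point (b , 1) lies in w - 1 generic triples of layer 0 and in the vertical
  -- triple of b, so the columns are rearranged: a vertical triple with residue a is counted in
  -- column |a| - 1, in place of the generic triple of that column which would contain (0 , 0).
  columnOf : Kind → ℕ → ℕ → ℕ
  columnOf generic  j a = j
  columnOf vertical j a = pred (absₘ a)

  column₂ : Index → ℕ
  column₂ (j , a , i) = columnOf (kind j (a , i)) j a

  vertical-layer₂ : ∀ {b} → b < m → b ≢ 0 → half b ≤ w →
                    pred (half b) < w × kind (pred (half b)) (b , 2F) ≡ vertical
  vertical-layer₂ {b} b<m b≢0 y≤w = j<w , kind-vertical₂ {j} (≈⇒≡ b<m (twoD<m j<w) (begin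
    b           ≈⟨ half-double b ⟨
    y + y       ≡⟨ cong (λ t → t + t) 1+j≡y ⟨
    twoD j      ∎))
    where
    open ≈-Reasoning
    y = half b
    y≢0 : y ≢ 0
    y≢0 y≡0 = b≢0 (≈⇒≡ b<m (s≤s z≤n) (begin
      b           ≈⟨ half-double b ⟨
      y + y       ≡⟨ cong (λ t → t + t) y≡0 ⟩
      0           ∎))
    j = pred y
    1+j≡y : suc j ≡ y
    1+j≡y = suc-pred y {{≢-nonZero y≢0}}
    j<w : j < w
    j<w = subst (_≤ w) (sym 1+j≡y) y≤w

  vertical-layer₀ : ∀ {b} → b < m → ¬ half b ≤ w →
                    pred (m ∸ half b) < w × kind (pred (m ∸ half b)) (b , 0F) ≡ vertical
  vertical-layer₀ {b} b<m y≰w = j<w , kind-vertical₀ {j} (≈-neg⇒≡ b<m (s≤s z≤n) (<⇒≤ (twoD<m j<w)) (begin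
    b + twoD j              ≡⟨ cong (λ t → b + (t + t)) 1+j≡d ⟩
    b + (d + d)             ≈⟨ ≈+ʳ (d + d) (half-double b) ⟨
    y + y + (d + d)         ≡⟨ regroup y d ⟩
    (y + d) + (y + d)       ≡⟨ cong (λ t → t + t) (m+[n∸m]≡n (<⇒≤ (half<m b))) ⟩
    m + m                   ≈⟨ ≈+ m≈0 m≈0 ⟩
    0                       ∎))
    where
    open ≈-Reasoning
    y = half b
    d = m ∸ y
    j = pred d
    1+j≡d : suc j ≡ d
    1+j≡d = suc-pred d {{>-nonZero (m<n⇒0<n∸m (half<m b))}}
    j<w : j < w
    j<w = subst (_≤ w) (sym 1+j≡d) (m∸d≤w (≰⇒> y≰w))
    regroup : ∀ y d → y + y + (d + d) ≡ (y + d) + (y + d)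
    regroup = solve-∀

  verticalIndex-sound : ∀ {b} → b < m → b ≢ 0 →
    IsIndex (verticalIndex b) × block (verticalIndex b) 2F ≡ (b , 1F) × column₂ (verticalIndex b) ≡ pred (absₘ b)
  verticalIndex-sound {b} b<m b≢0 with half b ≤? w
  ... | yes y≤w with vertical-layer₂ b<m b≢0 y≤w
  ...   | j<w , kind≡ = mkIndex j<w (mkPoint b<m tt) ,
                        cong (λ κ → entryOf κ (pred (half b)) (b , 2F) 2F) kind≡ ,
                        cong (λ κ → columnOf κ (pred (half b)) b) kind≡
  verticalIndex-sound {b} b<m b≢0 | no y≰w with vertical-layer₀ b<m y≰w
  ...   | j<w , kind≡ = mkIndex j<w (mkPoint b<m b≢0) ,
                        cong (λ κ → entryOf κ (pred (m ∸ half b)) (b , 0F) 2F) kind≡ ,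
                        cong (λ κ → columnOf κ (pred (m ∸ half b)) b) kind≡

  pred-absₘ<w : ∀ {a} → a < m → 0 < a → pred (absₘ a) < w
  pred-absₘ<w {a} a<m 0<a with absₘ-bounds a<m 0<a
  ... | 0<abs , abs≤w = subst (_≤ w) (sym (suc-pred (absₘ a) {{>-nonZero 0<abs}})) abs≤w

  source₂ : ℕ → Point → Index
  source₂ j (b , 0F) = (j , (b + twoD j) % m , 2F)
  source₂ j (b , 1F) = if? absₘ b ≟ suc j then verticalIndex b else (j , (b + (m ∸ suc j)) % m , 0F)
  source₂ j (b , 2F) = (j , (b + (m ∸ suc j)) % m , 1F)

  module _ {j : ℕ} (j<w : j < w) where
    private
      d = suc j
      d<m : d < m
      d<m = ≤-<-trans j<w w<m
      d+[m∸d]≈0 : d + (m ∸ d) ≈ 0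
      d+[m∸d]≈0 = +∸≈0 (<⇒≤ d<m)
      [m∸d]+d≈0 : (m ∸ d) + d ≈ 0
      [m∸d]+d≈0 = ∸+≈0 (<⇒≤ d<m)
      m∸d<m : m ∸ d < m
      m∸d<m = ∸-monoʳ-< (s≤s z≤n) (<⇒≤ d<m)
      twice[m∸d]≈negTwoD : (m ∸ d) + (m ∸ d) ≈ negTwoD j
      twice[m∸d]≈negTwoD = cancelʳ (twoD j) (begin
        (m ∸ d) + (m ∸ d) + (d + d)     ≡⟨ regroup (m ∸ d) d ⟩
        ((m ∸ d) + d) + ((m ∸ d) + d)   ≈⟨ ≈+ [m∸d]+d≈0 [m∸d]+d≈0 ⟩
        0                               ≈⟨ negTwoD+twoD≈0 j<w ⟨
        negTwoD j + twoD j              ∎)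
        where
        open ≈-Reasoning
        regroup : ∀ x y → x + x + (y + y) ≡ (x + y) + (x + y)
        regroup = solve-∀

    source₂-sound : ∀ {p} → IsPoint p →
                    IsIndex (source₂ j p) × block (source₂ j p) 2F ≡ p × column₂ (source₂ j p) ≡ j
    source₂-sound {b , 0F} (mkPoint b<m b≢0) =
      mkIndex j<w (mkPoint (%<m (b + twoD j)) tt) ,
      trans (cong (λ κ → entryOf κ j (a , 2F) 2F) kind≡)
            (cong (_, 0F) (shift-back (twoD j) (negTwoD j) b<m (twoD+negTwoD≈0 j<w))) ,
      cong (λ κ → columnOf κ j a) kind≡
      where
      a = (b + twoD j) % m
      kind≡ : kind j (a , 2F) ≡ generic
      kind≡ = kind-generic₂ {j} (λ a≡ → b≢0 (shift-unique b<m (s≤s z≤n) a≡ ≈-refl))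
    source₂-sound {b , 2F} (mkPoint b<m _) =
      mkIndex j<w (mkPoint (%<m (b + (m ∸ d))) tt) , cong (_, 2F) (shift-back (m ∸ d) d b<m [m∸d]+d≈0) , refl
    source₂-sound {b , 1F} (mkPoint b<m _) with absₘ b ≟ suc j
    ... | yes abs≡ with verticalIndex-sound b<m (λ b≡0 → 0≢1+n (trans (sym (absₘ-pos z≤n (≡⇒≈ b≡0))) abs≡))
    ...   | X , entry≡ , column≡ = X , entry≡ , trans column≡ (cong pred abs≡)
    source₂-sound {b , 1F} (mkPoint b<m _) | no abs≢ =
      mkIndex j<w (mkPoint (%<m (b + (m ∸ d))) a≢0) ,
      trans (cong (λ κ → entryOf κ j (a , 0F) 2F) kind≡) (cong (_, 1F) (shift-back (m ∸ d) d b<m [m∸d]+d≈0)) ,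
      cong (λ κ → columnOf κ j a) kind≡
      where
      a = (b + (m ∸ d)) % m
      a≢0 : a ≢ 0
      a≢0 a≡0 = abs≢ (absₘ-pos j<w (≡⇒≈ (shift-unique b<m d<m a≡0 d+[m∸d]≈0)))
      kind≡ : kind j (a , 0F) ≡ generic
      kind≡ = kind-generic₀ {j} (λ a≡ → abs≢ (absₘ-neg (s≤s z≤n) j<w
                (≈-trans (≈+ʳ d (≡⇒≈ (shift-unique b<m m∸d<m a≡ twice[m∸d]≈negTwoD))) [m∸d]+d≈0)))

    source₂-vertical : ∀ {a i} → IsPoint (a , i) → 0 < a → kind j (a , i) ≡ vertical →
                       source₂ (pred (absₘ a)) (a , 1F) ≡ (j , a , i)
    source₂-vertical {a} {i} (mkPoint a<m p) 0<a kind≡ with absₘ a ≟ suc (pred (absₘ a))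
    ... | yes _ = verticalIndex-complete (mkIndex j<w (mkPoint a<m p)) kind≡
    ... | no ¬s = ⊥-elim (¬s (sym (suc-pred (absₘ a) {{>-nonZero (proj₁ (absₘ-bounds a<m 0<a))}})))

    source₂-block : ∀ {a i} → IsPoint (a , i) → source₂ (column₂ (j , a , i)) (block (j , a , i) 2F) ≡ (j , a , i)
    source₂-block {a} {i} (mkPoint a<m p) with kind j (a , i) | kindView j a i
    ... | .generic | generic₀ a≢ with absₘ ((a + d) % m) ≟ suc j
    ...   | yes abs≡ = ⊥-elim (neither (absₘ-inv abs≡))
      where
      -- |a + d| = d forces a ≈ 0 or a ≈ -2d, both excluded for a generic triple of layer 0.
      neither : (a + d) % m ≈ d ⊎ (a + d) % m + d ≈ 0 → ⊥
      neither (inj₁ q) = p (≈⇒≡ a<m (s≤s z≤n) (cancelʳ d (≈-trans (≈-sym (%≈ (a + d))) q)))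
      neither (inj₂ q) = a≢ (≈-neg⇒≡ a<m (s≤s z≤n) (<⇒≤ (twoD<m j<w)) (begin
        a + (d + d)         ≡⟨ +-assoc a d d ⟨
        a + d + d           ≈⟨ ≈+ʳ d (%≈ (a + d)) ⟨
        (a + d) % m + d     ≈⟨ q ⟩
        0                   ∎))
        where open ≈-Reasoning
    ...   | no _ = cong (λ a' → (j , a' , 0F)) (shift-back d (m ∸ d) a<m d+[m∸d]≈0)
    source₂-block (mkPoint a<m _) | .generic | generic₁ =
      cong (λ a' → (j , a' , 1F)) (shift-back d (m ∸ d) a<m d+[m∸d]≈0)
    source₂-block (mkPoint a<m _) | .generic | generic₂ _ =
      cong (λ a' → (j , a' , 2F)) (shift-back (negTwoD j) (twoD j) a<m (negTwoD+twoD≈0 j<w))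
    source₂-block P | .vertical | vertical₀ a≡ =
      source₂-vertical P (subst (0 <_) (sym a≡) (0<negTwoD j<w)) (kind-vertical₀ {j} a≡)
    source₂-block P | .vertical | vertical₂ a≡ =
      source₂-vertical P (subst (0 <_) (sym a≡) (s≤s z≤n)) (kind-vertical₂ {j} a≡)

    column₂<w : ∀ {a i} → IsPoint (a , i) → column₂ (j , a , i) < w
    column₂<w {a} {i} (mkPoint a<m p) with kind j (a , i) | kindView j a i
    ... | .generic  | generic₀ _  = j<w
    ... | .generic  | generic₁    = j<w
    ... | .generic  | generic₂ _  = j<w
    ... | .vertical | vertical₀ a≡ = pred-absₘ<w a<m (subst (0 <_) (sym a≡) (0<negTwoD j<w))
    ... | .vertical | vertical₂ a≡ = pred-absₘ<w a<m (subst (0 <_) (sym a≡) (s≤s z≤n))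


  balanced₂ : Balanced 2F
  balanced₂ = record
    { column         = column₂
    ; source         = λ (j , p) → source₂ j p
    ; column<w       = λ (mkIndex j<w P) → column₂<w j<w P
    ; source-isIndex = λ (mkIndex j<w P) → proj₁ (source₂-sound j<w P)
    ; target-source  = λ (mkIndex j<w P) →
                         let (_ , entry≡ , column≡) = source₂-sound j<w P in cong₂ _,_ column≡ entry≡
    ; source-target  = λ (mkIndex j<w P) → source₂-block j<w P
    }

module Realisation (v : ℕ) where
  open import Data.Nat using (ℕ; zero; suc; pred; _+_; _*_; _∸_; _<_; z≤n; s≤s; s≤s⁻¹; NonZero; >-nonZero; _%_; _/_)
  open import Data.Nat.Properties
  open import Data.Nat.DivMod
  open import Data.Nat.Divisibility using (n∣m*n)
  open import Data.Nat.Tactic.RingSolver using (solve-∀)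
  open import Data.Empty using (⊥-elim)
  open import Data.Unit using (tt)
  open import Data.Product using (_×_; _,_; proj₁; proj₂)
  open import Data.Sum using (inj₁)
  open import Data.Fin using (Fin; toℕ; fromℕ<)
  import Data.Fin.Properties as Fin
  open import Data.Fin.Patterns using (0F; 1F; 2F)
  open import Data.Maybe using (just)
  open import Data.Maybe.Properties using (just-injective; ≡-dec)
  open import Data.Fin.Permutation using (Permutation; permutation; _⟨$⟩ʳ_)
  open import Relation.Binary.PropositionalEquality
  open Counting
  open Balance v

  M : ℕ
  M = 6 * w + 2

  n : ℕ
  n = 6 * w * w + 2 * w

  m*3≡1+M : m * 3 ≡ suc M
  m*3≡1+M = lemma v
    where
    lemma : ∀ v → suc (suc v + suc v) * 3 ≡ suc (6 * suc v + 2)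
    lemma = solve-∀

  n≡w*M : n ≡ w * M
  n≡w*M = lemma w
    where
    lemma : ∀ w → 6 * w * w + 2 * w ≡ w * (6 * w + 2)
    lemma = solve-∀

  divMod-unique : ∀ {N} .{{_ : NonZero N}} r q → r < N → (r + q * N) % N ≡ r × (r + q * N) / N ≡ q
  divMod-unique {N} r q r<N =
    trans ([m+kn]%n≡m%n r q N) (m<n⇒m%n≡m r<N) ,
    trans (+-distrib-/-∣ʳ r (n∣m*n q)) (cong₂ _+_ (m<n⇒m/n≡0 r<N) (m*n/n≡m q N))

  -- Points as numbers below M: (a , i) ↦ 3a + i - 1, which skips only the origin.
  code : Point → ℕ
  code (a , i) = pred (toℕ i + a * 3)

  decodePoint : ℕ → Point
  decodePoint c = (suc c / 3 , suc c mod 3)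

  offOrigin⇒0< : ∀ {a} i → OffOrigin a i → 0 < toℕ i + a * 3
  offOrigin⇒0< {zero}  0F a≢0 = ⊥-elim (a≢0 refl)
  offOrigin⇒0< {suc a} 0F _   = s≤s z≤n
  offOrigin⇒0<         1F _   = s≤s z≤n
  offOrigin⇒0<         2F _   = s≤s z≤n

  0<⇒offOrigin : ∀ a i → 0 < toℕ i + a * 3 → OffOrigin a i
  0<⇒offOrigin a 0F 0< a≡0 = <⇒≢ 0< (sym (cong (_* 3) a≡0))
  0<⇒offOrigin a 1F _ = tt
  0<⇒offOrigin a 2F _ = tt

  suc-code : ∀ {p} → IsPoint p → suc (code p) ≡ toℕ (proj₂ p) + proj₁ p * 3
  suc-code {a , i} (mkPoint _ off) = suc-pred (toℕ i + a * 3) {{>-nonZero (offOrigin⇒0< i off)}}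

  code<M : ∀ {p} → IsPoint p → code p < M
  code<M {a , i} P@(mkPoint a<m _) = s≤s⁻¹ (begin-strict
    suc (code (a , i))      ≡⟨ suc-code P ⟩
    toℕ i + a * 3           <⟨ +-monoˡ-< (a * 3) (Fin.toℕ<n i) ⟩
    3 + a * 3               ≡⟨⟩
    suc a * 3               ≤⟨ *-monoˡ-≤ 3 a<m ⟩
    m * 3                   ≡⟨ m*3≡1+M ⟩
    suc M                   ∎)
    where open ≤-Reasoning

  decodePoint-code : ∀ {p} → IsPoint p → decodePoint (code p) ≡ p
  decodePoint-code {a , i} P with divMod-unique (toℕ i) a (Fin.toℕ<n i)
  ... | rem≡ , quot≡ = cong₂ _,_
    (trans (cong (_/ 3) (suc-code P)) quot≡)
    (trans (Fin.fromℕ<-cong _ _ (trans (cong (_% 3) (suc-code P)) rem≡) (m%n<n (suc (code (a , i))) 3) (Fin.toℕ<n i))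
           (Fin.fromℕ<-toℕ i (Fin.toℕ<n i)))

  decodePoint-sum : ∀ c → toℕ (suc c mod 3) + suc c / 3 * 3 ≡ suc c
  decodePoint-sum c = begin
    toℕ (suc c mod 3) + suc c / 3 * 3   ≡⟨ cong (_+ suc c / 3 * 3) (Fin.toℕ-fromℕ< (m%n<n (suc c) 3)) ⟩
    suc c % 3 + suc c / 3 * 3           ≡⟨ m≡m%n+[m/n]*n (suc c) 3 ⟨
    suc c                               ∎
    where open ≡-Reasoning

  code-decodePoint : ∀ c → code (decodePoint c) ≡ c
  code-decodePoint c = cong pred (decodePoint-sum c)

  decodePoint-isPoint : ∀ {c} → c < M → IsPoint (decodePoint c)
  decodePoint-isPoint {c} c<M = mkPoint
    (m<n*o⇒m/o<n {n = m} {o = 3} (subst (suc c <_) (sym m*3≡1+M) (s≤s c<M)))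
    (0<⇒offOrigin _ (suc c mod 3) (subst (0 <_) (sym (decodePoint-sum c)) (s≤s z≤n)))

  encode : Index → ℕ
  encode (j , p) = code p + j * M

  decodeIndex : ℕ → Index
  decodeIndex t = (t / M , decodePoint (t % M))

  encode<n : ∀ {x} → IsIndex x → encode x < n
  encode<n {j , p} (mkIndex j<w P) = begin-strict
    code p + j * M    <⟨ +-monoˡ-< (j * M) (code<M P) ⟩
    M + j * M         ≡⟨⟩
    suc j * M         ≤⟨ *-monoˡ-≤ M j<w ⟩
    w * M             ≡⟨ n≡w*M ⟨
    n                 ∎
    where open ≤-Reasoning

  decodeIndex-encode : ∀ {x} → IsIndex x → decodeIndex (encode x) ≡ x
  decodeIndex-encode {j , p} (mkIndex _ P) with divMod-unique (code p) j (code<M P)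
  ... | rem≡ , quot≡ = cong₂ _,_ quot≡ (trans (cong decodePoint rem≡) (decodePoint-code P))

  encode-decodeIndex : ∀ t → encode (decodeIndex t) ≡ t
  encode-decodeIndex t = begin
    code (decodePoint (t % M)) + t / M * M   ≡⟨ cong (_+ t / M * M) (code-decodePoint (t % M)) ⟩
    t % M + t / M * M                        ≡⟨ m≡m%n+[m/n]*n t M ⟨
    t                                        ∎
    where open ≡-Reasoning

  decodeIndex-isIndex : ∀ {t} → t < n → IsIndex (decodeIndex t)
  decodeIndex-isIndex {t} t<n = mkIndex (m<n*o⇒m/o<n (subst (t <_) n≡w*M t<n)) (decodePoint-isPoint (m%n<n t M))

  indexOf : Fin n → Index
  indexOf t = decodeIndex (toℕ t)

  indexOf-isIndex : ∀ t → IsIndex (indexOf t)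
  indexOf-isIndex t = decodeIndex-isIndex (Fin.toℕ<n t)

  indexOf-injective : ∀ {t u} → indexOf t ≡ indexOf u → t ≡ u
  indexOf-injective {t} {u} eq = Fin.toℕ-injective (begin
    toℕ t                  ≡⟨ encode-decodeIndex (toℕ t) ⟨
    encode (indexOf t)     ≡⟨ cong encode eq ⟩
    encode (indexOf u)     ≡⟨ encode-decodeIndex (toℕ u) ⟩
    toℕ u                  ∎)
    where open ≡-Reasoning

  indexFin : ∀ x → IsIndex x → Fin n
  indexFin x X = fromℕ< (encode<n X)

  indexOf-indexFin : ∀ {x} (X : IsIndex x) → indexOf (indexFin x X) ≡ x
  indexOf-indexFin {x} X = trans (cong decodeIndex (Fin.toℕ-fromℕ< (encode<n X))) (decodeIndex-encode X)

  pointFin : Point → Fin M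
  pointFin p = code p mod M

  toℕ-pointFin : ∀ p → toℕ (pointFin p) ≡ code p % M
  toℕ-pointFin p = Fin.toℕ-fromℕ< (m%n<n (code p) M)

  pointFin-injective : ∀ {p q} → IsPoint p → IsPoint q → pointFin p ≡ pointFin q → p ≡ q
  pointFin-injective {p} {q} P Q eq = begin
    p                      ≡⟨ decodePoint-code P ⟨
    decodePoint (code p)   ≡⟨ cong decodePoint codes≡ ⟩
    decodePoint (code q)   ≡⟨ decodePoint-code Q ⟩
    q                      ∎
    where
    open ≡-Reasoning
    codes≡ : code p ≡ code q
    codes≡ = begin
      code p          ≡⟨ m<n⇒m%n≡m (code<M P) ⟨
      code p % M      ≡⟨ toℕ-pointFin p ⟨
      toℕ (pointFin p) ≡⟨ cong toℕ eq ⟩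
      toℕ (pointFin q) ≡⟨ toℕ-pointFin q ⟩
      code q % M      ≡⟨ m<n⇒m%n≡m (code<M Q) ⟩
      code q          ∎

  triples : Triples M n
  triples t k = just (pointFin (block (indexOf t) k))

  -- In a balanced position k every point occurs exactly w times: relabelling the triples by
  -- the inverse of x ↦ (column x , block x k) puts the point with code c exactly at the
  -- indices congruent to c modulo M.
  module Occurrences {k : Fin 3} (B : Balanced k) where
    open Balanced B

    target : Index → Index
    target x = (column x , block x k)

    target-isIndex : ∀ {x} → IsIndex x → IsIndex (target x)
    target-isIndex X = mkIndex (column<w X) (block-isPoint X k)

    toSource toTarget : Fin n → Fin n
    toSource t = indexFin (source (indexOf t)) (source-isIndex (indexOf-isIndex t))
    toTarget t = indexFin (target (indexOf t)) (target-isIndex (indexOf-isIndex t))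

    indexOf-toSource : ∀ t → indexOf (toSource t) ≡ source (indexOf t)
    indexOf-toSource t = indexOf-indexFin (source-isIndex (indexOf-isIndex t))

    indexOf-toTarget : ∀ t → indexOf (toTarget t) ≡ target (indexOf t)
    indexOf-toTarget t = indexOf-indexFin (target-isIndex (indexOf-isIndex t))

    relabel : Permutation n n
    relabel = permutation toSource toTarget
      (λ t → indexOf-injective (begin
        indexOf (toSource (toTarget t))     ≡⟨ indexOf-toSource (toTarget t) ⟩
        source (indexOf (toTarget t))       ≡⟨ cong source (indexOf-toTarget t) ⟩
        source (target (indexOf t))         ≡⟨ source-target (indexOf-isIndex t) ⟩
        indexOf t                           ∎))
      (λ t → indexOf-injective (begin
        indexOf (toTarget (toSource t))     ≡⟨ indexOf-toTarget (toSource t) ⟩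
        target (indexOf (toSource t))       ≡⟨ cong target (indexOf-toSource t) ⟩
        target (source (indexOf t))         ≡⟨ target-source (indexOf-isIndex t) ⟩
        indexOf t                           ∎))
      where open ≡-Reasoning

    toℕ-entry : ∀ t → toℕ (pointFin (block (indexOf (relabel ⟨$⟩ʳ t)) k)) ≡ toℕ t % M
    toℕ-entry t = begin
      toℕ (pointFin (block (indexOf (toSource t)) k))
        ≡⟨ cong (λ x → toℕ (pointFin (block x k))) (indexOf-toSource t) ⟩
      toℕ (pointFin (block (source (indexOf t)) k))
        ≡⟨ cong (λ y → toℕ (pointFin (proj₂ y))) (target-source (indexOf-isIndex t)) ⟩
      toℕ (pointFin (decodePoint (toℕ t % M)))          ≡⟨ toℕ-pointFin (decodePoint (toℕ t % M)) ⟩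
      code (decodePoint (toℕ t % M)) % M                ≡⟨ cong (_% M) (code-decodePoint (toℕ t % M)) ⟩
      toℕ t % M % M                                     ≡⟨ m%n%n≡m%n (toℕ t) M ⟩
      toℕ t % M                                         ∎
      where open ≡-Reasoning

    occurrences : ∀ x → occ triples k x ≡ w
    occurrences x = countViaResidues w M n≡w*M relabel (toℕ x) (Fin.toℕ<n x)
                      (λ t → ≡-dec Fin._≟_ (triples t k) (just x))
      (λ t eq → trans (sym (toℕ-entry t)) (cong toℕ (just-injective eq)))
      (λ t r≡x → cong just (Fin.toℕ-injective (trans (toℕ-entry t) r≡x)))

  lambda≡3 : lambda w w w ≡ 3
  lambda≡3 = trans (cong (_/ w) 4w∸1≡v+3w) (proj₂ (divMod-unique v 3 (n<1+n v)))
    where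
    4w∸1≡v+3w : w + w + w + w ∸ 1 ≡ v + 3 * w
    4w∸1≡v+3w = trans (cong (_∸ 1) (+-suc (w + w + w) v)) (lemma v)
      where
      lemma : ∀ v → suc v + suc v + suc v + v ≡ v + 3 * suc v
      lemma = solve-∀

  entry-isPoint : ∀ t k → IsPoint (block (indexOf t) k)
  entry-isPoint t = block-isPoint (indexOf-isIndex t)

  entries-equal : ∀ {t u k l x} → triples t k ≡ just x → triples u l ≡ just x →
                  block (indexOf t) k ≡ block (indexOf u) l
  entries-equal {t} {u} {k} {l} eqₜ eqᵤ =
    pointFin-injective (entry-isPoint t k) (entry-isPoint u l) (just-injective (trans eqₜ (sym eqᵤ)))

  entries-distinct : ∀ t k l x → k ≢ l → triples t k ≡ just x → triples t l ≢ just x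
  entries-distinct t k l _ k≢l eqₖ eqₗ =
    block-distinct (indexOf-isIndex t) k l k≢l (entries-equal {t} {t} {k} {l} eqₖ eqₗ)

  pairs-in-one-triple : ∀ (t u : Fin n) (x y : Fin M) → x ≢ y →
                        x ∈ₜ triples t → y ∈ₜ triples t → x ∈ₜ triples u → y ∈ₜ triples u → t ≡ u
  pairs-in-one-triple t u x y x≢y (k , xₜ) (l , yₜ) (k' , xᵤ) (l' , yᵤ) =
    indexOf-injective (blocks-sharing-pair (indexOf-isIndex t) (indexOf-isIndex u)
      (positionsDiffer {t} xₜ yₜ) (positionsDiffer {u} xᵤ yᵤ)
      (entries-equal {t} {u} {k} {k'} xₜ xᵤ) (entries-equal {t} {u} {l} {l'} yₜ yᵤ))
    where
    positionsDiffer : ∀ {s k l} → triples s k ≡ just x → triples s l ≡ just y → k ≢ l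
    positionsDiffer {s} eqₓ eqᵧ refl = x≢y (just-injective (trans (sym eqₓ) eqᵧ))

  packing : IsBalancedPacking M w w w {n} triples
  packing = record
    { distinct = entries-distinct
    ; blockSz  = λ _ → inj₁ (sym lambda≡3)
    ; pairs    = pairs-in-one-triple
    ; balance₁ = Occurrences.occurrences balanced₀
    ; balance₂ = Occurrences.occurrences balanced₁
    ; balance₃ = Occurrences.occurrences balanced₂
    }

proposition16 : (w₁ : ℕ) → .{{_ : NonZero w₁}} →
    ∃[ A ] IsBalancedPacking (6 * w₁ + 2) w₁ w₁ w₁ {6 * w₁ * w₁ + 2 * w₁} A
proposition16 zero    = ⊥-elim (≢-nonZero⁻¹ 0 refl)
proposition16 (suc v) = Realisation.triples v , Realisation.packing v
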